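{- Let $G=(V,A)$ be a permutation DAG and $\gamma$ a topological ordering of $V$ such that $\alpha(G,\gamma)$ is finite. Then $$\alpha(G,\gamma)=1+\max\Big\{\sum_{e\in P}w(e) : P \text{ is a (directed) path in } H(G,\gamma)\Big\}.$$
   Context: For a sequence $\sigma=(\sigma(1),\ldots,\sigma(n))$, $\mathsf{PermDAG}(\sigma)$ has vertex set $\{t_1,\ldots,t_n\}$ and an arc $(t_j,t_i)$ for every $i<j$ with $\sigma(i)\le\sigma(j)$. A directed graph is a permutation DAG if it is isomorphic to $\mathsf{PermDAG}(\tau)$ for some sequence $\tau$. A topological ordering of an $n$-vertex DAG $G=(V,A)$ is a bijection $\gamma:V\to[n]$ with $\gamma(u)<\gamma(v)$ for every arc $(v,u)\in A$. $\alpha(G,\gamma)$ is the minimum $k$ such that some $\tau\in[k]^n$ has $\mathsf{PermDAG}(\tau)$ isomorphic to $G$ under $\phi(t_i)=\gamma^{ -1}(i)$ ($\infty$ if none exists). Let $\overrightarrow{E}:=\{(u,v):\gamma(u)<\gamma(v)\text{ and }(v,u)\notin A\}$, $H(G,\gamma):=(V,A\cup\overrightarrow{E})$, and $w:A\cup\overrightarrow{E}\to\{0,1\}$ with $w(e)=0$ for $e\in A$ and $w(e)=1$ for $e\in\overrightarrow{E}$. -}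

module Defs where

open import Data.Nat using (ℕ; zero; suc; _+_; _≤_)
open import Data.Fin using (Fin) renaming (_<_ to _<ᶠ_; _≤_ to _≤ᶠ_)
open import Data.List using (List; []; _∷_)
open import Data.List.Relation.Unary.Unique.Propositional using (Unique)
open import Data.Product using (Σ; ∃; _×_; _,_)
open import Relation.Nullary using (¬_)
open import Function.Bundles using (_↔_; _⇔_; Inverse)

Digraph : ℕ → Set₁
Digraph n = Fin n → Fin n → Set

PermDAG : ∀ {n} → (Fin n → ℕ) → Digraph n
PermDAG σ j i = (i <ᶠ j) × (σ i ≤ σ j)

IsoVia : ∀ {n} → Digraph n → Digraph n → (Fin n ↔ Fin n) → Set
IsoVia G' G φ = ∀ x y → (G' x y ⇔ G (Inverse.to φ x) (Inverse.to φ y))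

IsPermutationDAG : ∀ {n} → Digraph n → Set
IsPermutationDAG {n} G = Σ (Fin n → ℕ) λ τ → Σ (Fin n ↔ Fin n) λ φ → IsoVia (PermDAG τ) G φ

IsTopologicalOrdering : ∀ {n} → Digraph n → (Fin n ↔ Fin n) → Set
IsTopologicalOrdering G γ = ∀ v u → G v u → Inverse.to γ u <ᶠ Inverse.to γ v

Realizes : ∀ {n} → Digraph n → (Fin n ↔ Fin n) → ℕ → (Fin n → ℕ) → Set
Realizes {n} G γ k τ =
  (∀ i → (1 ≤ τ i) × (τ i ≤ k)) ×
  (∀ i j → (PermDAG τ i j ⇔ G (Inverse.from γ i) (Inverse.from γ j)))

Realizable : ∀ {n} → Digraph n → (Fin n ↔ Fin n) → ℕ → Set
Realizable {n} G γ k = Σ (Fin n → ℕ) λ τ → Realizes G γ k τ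

IsAlpha : ∀ {n} → Digraph n → (Fin n ↔ Fin n) → ℕ → Set
IsAlpha G γ a = Realizable G γ a × (∀ k → Realizable G γ k → a ≤ k)

AlphaFinite : ∀ {n} → Digraph n → (Fin n ↔ Fin n) → Set
AlphaFinite G γ = ∃ λ k → Realizable G γ k

EArc : ∀ {n} → Digraph n → (Fin n ↔ Fin n) → Digraph n
EArc G γ u v = (Inverse.to γ u <ᶠ Inverse.to γ v) × ¬ G v u

data HArc {n} (G : Digraph n) (γ : Fin n ↔ Fin n) : Fin n → Fin n → ℕ → Set where
  arcA : ∀ {u v} → G u v → HArc G γ u v 0
  arcE : ∀ {u v} → EArc G γ u v → HArc G γ u v 1

data HWalk {n} (G : Digraph n) (γ : Fin n ↔ Fin n) : List (Fin n) → ℕ → Set where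
  single : ∀ v → HWalk G γ (v ∷ []) 0
  step   : ∀ {u v vs w m} → HArc G γ u v w → HWalk G γ (v ∷ vs) m →
           HWalk G γ (u ∷ v ∷ vs) (w + m)

HPathWeight : ∀ {n} → Digraph n → (Fin n ↔ Fin n) → List (Fin n) → ℕ → Set
HPathWeight G γ vs m = Unique vs × HWalk G γ vs m

IsMaxPathWeight : ∀ {n} → Digraph n → (Fin n ↔ Fin n) → ℕ → Set
IsMaxPathWeight {n} G γ M =
  (Σ (List (Fin n)) λ vs → HPathWeight G γ vs M) ×
  (∀ vs m → HPathWeight G γ vs m → m ≤ M)

-- A realization τ of G labels each vertex u with τ(γ u), and every arc of H(G,γ) from u to v
-- with weight w forces w + τ(γ v) ≤ τ(γ u); so a path of weight m starting at u needs
-- τ(γ u) ≥ m + 1, giving α ≥ 1 + M. Conversely H(G,γ) is acyclic, so we may label u with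
-- 1 + (the heaviest weight of a path starting at u). Arcs of G are respected because they are
-- weight-0 arcs of H, and a non-arc backwards in γ is a weight-1 arc of H pointing the other
-- way; hence these labels realize G with largest label 1 + M.
module Submission where

open import Defs
open import Data.Nat using (ℕ; zero; suc; _+_; _*_; _≤_; _<_; z≤n; s≤s)
open import Data.Nat.Properties
open import Data.Fin using (Fin; toℕ) renaming (_<_ to _<ᶠ_; zero to fzero)
import Data.Fin.Properties as Fin
open import Data.List using (List; []; _∷_; map; allFin)
open import Data.List.Extrema ≤-totalOrder using (argmax; f[xs]≤f[argmax])
open import Data.List.Membership.Propositional.Properties using (∈-map⁺; ∈-allFin)
open import Data.List.Relation.Unary.All as All using (All; []; _∷_)
open import Data.List.Relation.Unary.AllPairs using ([]; _∷_)
open import Data.List.Relation.Unary.Unique.Propositional using (Unique)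
open import Data.Product using (Σ; ∃; _×_; _,_; proj₁; proj₂)
open import Data.Empty using (⊥-elim)
open import Relation.Binary.Definitions using (Decidable)
open import Relation.Nullary using (Dec; yes; no)
open import Relation.Nullary.Decidable using (map′; _×-dec_; ¬?; decidable-stable)
open import Relation.Binary.PropositionalEquality using (_≡_; refl; sym; cong; subst₂)
open import Function.Bundles using (_↔_; _⇔_; Inverse; Equivalence; mk⇔)

Represents : ∀ {n} → Digraph n → (Fin n ↔ Fin n) → (Fin n → ℕ) → Set
Represents G γ τ = ∀ i j → PermDAG τ i j ⇔ G (Inverse.from γ i) (Inverse.from γ j)

module Realization {n} {G : Digraph n} {γ : Fin n ↔ Fin n} {τ : Fin n → ℕ}
  (rep : Represents G γ τ) where

  to : Fin n → Fin n
  to = Inverse.to γ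

  label : Fin n → ℕ
  label u = τ (to u)

  from∘to : ∀ u → Inverse.from γ (to u) ≡ u
  from∘to = Inverse.strictlyInverseʳ γ

  arc⇒ : ∀ {u v} → G u v → (to v <ᶠ to u) × (label v ≤ label u)
  arc⇒ {u} {v} g =
    Equivalence.from (rep (to u) (to v)) (subst₂ G (sym (from∘to u)) (sym (from∘to v)) g)

  arc⇐ : ∀ {u v} → (to v <ᶠ to u) × (label v ≤ label u) → G u v
  arc⇐ {u} {v} p = subst₂ G (from∘to u) (from∘to v) (Equivalence.to (rep (to u) (to v)) p)

  G? : Decidable G
  G? u v = map′ arc⇐ arc⇒ ((to v Fin.<? to u) ×-dec (label v ≤? label u))

  arc-weight+label≤ : ∀ {u v w} → HArc G γ u v w → w + label v ≤ label u
  arc-weight+label≤ (arcA g)         = proj₂ (arc⇒ g)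
  arc-weight+label≤ (arcE (lt , ¬g)) = ≰⇒> λ le → ¬g (arc⇐ (lt , le))

  walk-weight<label : (∀ i → 1 ≤ τ i) → ∀ {u vs m} → HWalk G γ (u ∷ vs) m → m < label u
  walk-weight<label pos (single v) = pos (to v)
  walk-weight<label pos (step {w = w} {m = m} a r) = begin-strict
    w + m        <⟨ +-monoʳ-< w (walk-weight<label pos r) ⟩
    w + label _  ≤⟨ arc-weight+label≤ a ⟩
    label _      ∎
    where open ≤-Reasoning

  -- Arcs of H decrease (label, γ) lexicographically; μ encodes that order in ℕ.
  μ : Fin n → ℕ
  μ u = label u * n + toℕ (to u)

  μ-decreasing : ∀ {u v w} → HArc G γ u v w → μ v < μ u
  μ-decreasing (arcA g) with arc⇒ g
  ... | lt , le = +-mono-≤-< (*-monoˡ-≤ n le) lt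
  μ-decreasing {u} {v} a@(arcE _) = begin-strict
    label v * n + toℕ (to v)  <⟨ +-monoʳ-< (label v * n) (Fin.toℕ<n (to v)) ⟩
    label v * n + n           ≡⟨ +-comm (label v * n) n ⟩
    suc (label v) * n         ≤⟨ *-monoˡ-≤ n (arc-weight+label≤ a) ⟩
    label u * n               ≤⟨ m≤m+n _ _ ⟩
    μ u                       ∎
    where open ≤-Reasoning

walk-weight<bound : ∀ {n} {G : Digraph n} {γ : Fin n ↔ Fin n} {k τ} → Realizes G γ k τ →
                    ∀ {u vs m} → HWalk G γ (u ∷ vs) m → m < k
walk-weight<bound {G = G} {γ} (bounded , rep) {u} p =
  ≤-trans (walk-weight<label (λ i → proj₁ (bounded i)) p) (proj₂ (bounded (Inverse.to γ u)))
  where open Realization {G = G} {γ} rep using (walk-weight<label)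

HArc-weight-unique : ∀ {n} {G : Digraph n} {γ : Fin n ↔ Fin n} → IsTopologicalOrdering G γ →
                     ∀ {u v w w′} → HArc G γ u v w → HArc G γ u v w′ → w ≡ w′
HArc-weight-unique topo (arcA _)        (arcA _)        = refl
HArc-weight-unique topo (arcE _)        (arcE _)        = refl
HArc-weight-unique topo (arcA g)        (arcE (lt , _)) = ⊥-elim (Fin.<-asym lt (topo _ _ g))
HArc-weight-unique topo (arcE (lt , _)) (arcA g)        = ⊥-elim (Fin.<-asym lt (topo _ _ g))

module LongestWalk {n} {G : Digraph n} {γ : Fin n ↔ Fin n}
  (topo : IsTopologicalOrdering G γ) (G? : Decidable G)
  (μ : Fin n → ℕ) (μ-decreasing : ∀ {u v w} → HArc G γ u v w → μ v < μ u) where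

  to from : Fin n → Fin n
  to = Inverse.to γ
  from = Inverse.from γ

  HArc? : ∀ u v → Dec (∃ (HArc G γ u v))
  HArc? u v with G? u v | (to u Fin.<? to v) ×-dec ¬? (G? v u)
  ... | yes g  | _      = yes (0 , arcA g)
  ... | no _   | yes e  = yes (1 , arcE e)
  ... | no ¬g  | no ¬e  = no λ { (_ , arcA g) → ¬g g ; (_ , arcE e) → ¬e e }

  walk-below : ∀ {u vs m} → HWalk G γ (u ∷ vs) m → All (λ x → μ x < μ u) vs
  walk-below (single _) = []
  walk-below (step a r) = μ-decreasing a ∷ All.map (λ lt → <-trans lt (μ-decreasing a)) (walk-below r)

  walk-unique : ∀ {vs m} → HWalk G γ vs m → Unique vs
  walk-unique (single _)   = [] ∷ []
  walk-unique w@(step _ r) =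
    All.map (λ lt eq → <-irrefl (cong μ (sym eq)) lt) (walk-below w) ∷ walk-unique r

  WalkFrom : Fin n → Set
  WalkFrom u = Σ (List (Fin n)) λ vs → Σ ℕ (HWalk G γ (u ∷ vs))

  weight : ∀ {u} → WalkFrom u → ℕ
  weight (_ , m , _) = m

  trivial : ∀ u → WalkFrom u
  trivial u = [] , 0 , single u

  prepend : ∀ {u v w} → HArc G γ u v w → WalkFrom v → WalkFrom u
  prepend {v = v} {w} a (vs , m , p) = v ∷ vs , w + m , step a p

  -- With fuel N this is a heaviest walk among those from u whose potential stays below N.
  longest : ℕ → ∀ u → WalkFrom u
  extend  : ℕ → ∀ u v → WalkFrom u
  longest zero    u = trivial u
  longest (suc N) u = argmax weight (trivial u) (map (extend N u) (allFin n))
  extend N u v with HArc? u v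
  ... | yes (_ , a) = prepend a (longest N v)
  ... | no _        = trivial u

  weight-extend : ∀ N {u v w} → HArc G γ u v w → weight (extend N u v) ≡ w + weight (longest N v)
  weight-extend N {u} {v} a with HArc? u v
  ... | yes (_ , a′) = cong (_+ weight (longest N v)) (HArc-weight-unique topo a′ a)
  ... | no ¬arc      = ⊥-elim (¬arc (_ , a))

  weight≤longest : ∀ N {u vs m} → HWalk G γ (u ∷ vs) m → μ u < N → m ≤ weight (longest N u)
  weight≤longest N       (single _) _ = z≤n
  weight≤longest (suc N) {u} (step {v = v} {w = w} {m = m} a r) (s≤s μu≤N) = begin
    w + m                       ≤⟨ +-monoʳ-≤ w (weight≤longest N r (<-≤-trans (μ-decreasing a) μu≤N)) ⟩
    w + weight (longest N v)    ≡⟨ weight-extend N a ⟨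
    weight (extend N u v)       ≤⟨ All.lookup extensions≤argmax (∈-map⁺ (extend N u) (∈-allFin v)) ⟩
    weight (longest (suc N) u)  ∎
    where
    open ≤-Reasoning
    extensions≤argmax : All (λ x → weight x ≤ weight (longest (suc N) u)) (map (extend N u) (allFin n))
    extensions≤argmax = f[xs]≤f[argmax] {f = weight} (trivial u) (map (extend N u) (allFin n))

  heaviestFrom : ∀ u → WalkFrom u
  heaviestFrom u = longest (suc (μ u)) u

  maxWeightFrom : Fin n → ℕ
  maxWeightFrom u = weight (heaviestFrom u)

  heaviestWalk : ∀ u → HWalk G γ (u ∷ proj₁ (heaviestFrom u)) (maxWeightFrom u)
  heaviestWalk u = proj₂ (proj₂ (heaviestFrom u))

  weight≤maxWeightFrom : ∀ {u vs m} → HWalk G γ (u ∷ vs) m → m ≤ maxWeightFrom u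
  weight≤maxWeightFrom w = weight≤longest _ w ≤-refl

  arc-weight+maxWeightFrom≤ : ∀ {u v w} → HArc G γ u v w → w + maxWeightFrom v ≤ maxWeightFrom u
  arc-weight+maxWeightFrom≤ a = weight≤maxWeightFrom (step a (heaviestWalk _))

  represents : Represents G γ (λ i → suc (maxWeightFrom (from i)))
  represents i j = mk⇔ forward backward
    where
    u = from i
    v = from j
    to∘from : ∀ k → to (from k) ≡ k
    to∘from = Inverse.strictlyInverseˡ γ

    -- A missing arc u → v would be a weight-1 arc v → u of H, making v strictly heavier than u.
    forward : PermDAG (λ k → suc (maxWeightFrom (from k))) i j → G u v
    forward (j<i , s≤s v≤u) = decidable-stable (G? u v) λ ¬g →
      <⇒≱ (arc-weight+maxWeightFrom≤ (arcE (subst₂ _<ᶠ_ (sym (to∘from j)) (sym (to∘from i)) j<i , ¬g)))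
          v≤u

    backward : G u v → PermDAG (λ k → suc (maxWeightFrom (from k))) i j
    backward g =
      subst₂ _<ᶠ_ (to∘from j) (to∘from i) (topo u v g) , s≤s (arc-weight+maxWeightFrom≤ (arcA g))

  module _ (u₀ : Fin n) where

    peak : Fin n
    peak = argmax maxWeightFrom u₀ (allFin n)

    maxWeightFrom≤peak : ∀ u → maxWeightFrom u ≤ maxWeightFrom peak
    maxWeightFrom≤peak u = All.lookup (f[xs]≤f[argmax] {f = maxWeightFrom} u₀ (allFin n)) (∈-allFin u)

    isMaxPathWeight : IsMaxPathWeight G γ (maxWeightFrom peak)
    isMaxPathWeight = (_ , walk-unique (heaviestWalk peak) , heaviestWalk peak) , bound
      where
      bound : ∀ vs m → HPathWeight G γ vs m → m ≤ maxWeightFrom peak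
      bound _ _ (_ , single _)     = z≤n
      bound _ _ (_ , q@(step _ _)) = ≤-trans (weight≤maxWeightFrom q) (maxWeightFrom≤peak _)

    realizes : Realizes G γ (1 + maxWeightFrom peak) (λ i → suc (maxWeightFrom (from i)))
    realizes = (λ i → s≤s z≤n , s≤s (maxWeightFrom≤peak (from i))) , represents

theorem3 : ∀ (n : ℕ) (G : Digraph (suc n)) (γ : Fin (suc n) ↔ Fin (suc n)) →
           IsPermutationDAG G → IsTopologicalOrdering G γ → AlphaFinite G γ →
           ∃ λ M → IsMaxPathWeight G γ M × IsAlpha G γ (1 + M)
theorem3 n G γ _ topo (_ , _ , _ , rep) =
  maxWeightFrom (peak fzero) , isMaxPathWeight fzero , (_ , realizes fzero) ,
  λ k (_ , r) → walk-weight<bound r (heaviestWalk (peak fzero))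
  where
  open Realization {G = G} {γ} rep using (G?; μ; μ-decreasing)
  open LongestWalk topo G? μ μ-decreasing
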